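{- Let $a$ be a weak composition with $a_j=0$ for all $j\neq 1,n$ and $a_n\ge a_1>0$. Then for every $T\in\mathrm{SSKD}(a)$ we have $\mathcal{E}_0(T)\in\mathrm{SSKD}(s_0\cdot a)$, where $s_0\cdot a=(a_n+1,a_2,\ldots,a_{n-1},a_1-1)$.
   Context: Fix $n\ge 2$. A weak composition is $a=(a_1,\ldots,a_n)\in\mathbb{Z}_{\ge0}^n$. Its diagram has $a_r$ cells left-justified in row $r$ (row $1$ at the bottom), in columns $1,\dots,a_r$; there is also a basement column $0$ whose cell in row $r$ has entry $r$. A filling assigns an entry in $\{1,\ldots,n\}$ to each cell. A filling is non-attacking if no two cells with the same entry lie in the same column, and no two cells with the same entry lie in adjacent columns $c,c+1$ with the cell in column $c$ in a strictly higher row. A triple consists of three cells (basement allowed): two cells in row $r$ in adjacent columns $c,c+1$, and a third cell either (Type I) in column $c$ in a row $s>r$ with $a_r>a_s$, or (Type II) in column $c+1$ in a row $s<r$ with $a_r\ge a_s$ (row lengths taken in the shape of the filling). Entries are compared as integers (basement entry = row index), equal entries being compared by regarding the one further right as smaller. For Type I let $\alpha,\beta,\gamma$ be the entries of the lower-left, lower-right, upper cell; for Type II of the upper-left, upper-right, lower cell. It is a co-inversion triple if $\alpha<\beta<\gamma$ or $\beta<\gamma<\alpha$ or $\gamma<\alpha<\beta$. $\mathrm{SSKD}(a)$ is the set of non-attacking fillings of the diagram of $a$ with no co-inversion triples. Affine embedding map $\mathcal{E}_0$, defined when $a_n\ge a_1>0$: for $T\in\mathrm{SSKD}(a)$, $\mathcal{E}_0(T)$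 is a filling of the diagram of $s_0\cdot a$. Let $y_k,x_k$ be the entries of $T$ in rows $n,1$ of column $k$. Rows $2,\ldots,n-1$ are copied from $T$, and row $1$, column $1$ of $\mathcal{E}_0(T)$ gets $x_1$. Inductively for $k=1,\ldots,a_1-1$, the cells (row $n$, column $k$) and (row $1$, column $k+1$) of $\mathcal{E}_0(T)$ receive $y_k$ and $x_{k+1}$ as follows: if row $1$, column $k$ of $\mathcal{E}_0(T)$ contains $x_k$, put $y_k$ in row $n$, column $k$ and $x_{k+1}$ in row $1$, column $k+1$, unless the three cells (row $1$, col $k$), (row $1$, col $k+1$), (row $n$, col $k$) then form a Type I co-inversion triple or contain an attacking pair, in which case put $x_{k+1}$ in row $n$, column $k$ and $y_k$ in row $1$, column $k+1$; otherwise row $1$, column $k$ contains $y_{k-1}$, and put $x_{k+1}$ in row $n$, column $k$ and $y_k$ in row $1$, column $k+1$, unless those three cells then form a Type I co-inversion triple or contain an attacking pair, in which case put $y_k$ in row $n$, column $k$ and $x_{k+1}$ in row $1$, column $k+1$. Finally the entries $y_{a_1},\ldots,y_{a_n}$ of row $n$ of $T$ are placed, in this order, in row $1$ of $\mathcal{E}_0(T)$ in columns $a_1+1,\ldots,a_n+1$. -}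

module Defs where

open import Data.Nat using (ℕ; zero; suc; _≤_; _<_; _∸_; _+_; _≟_; _<?_; _≤?_)
open import Data.Fin using (Fin; toℕ; fromℕ) renaming (zero to fzero; suc to fsuc; _≟_ to _≟ᶠ_)
open import Data.Bool using (Bool; true; false; if_then_else_)
open import Data.Product using (_×_; _,_; proj₁; proj₂)
open import Data.Sum using (_⊎_)
open import Relation.Binary.PropositionalEquality using (_≡_; _≢_)
open import Relation.Nullary using (¬_; Dec; does; yes; no)
open import Relation.Nullary.Decidable using (_×-dec_; _⊎-dec_)

-- Weak composition with n parts: row r : Fin n is row number (toℕ r + 1);
-- row 1 (bottom) is fzero.
Comp : ℕ → Set
Comp n = Fin n → ℕ

-- A filling: entry of the cell in row r, column c (c ≥ 1).  Values outside the
-- diagram are irrelevant (all predicates below only inspect cells of the diagram).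
Filling : ℕ → Set
Filling n = Fin n → ℕ → ℕ

-- Entry of a cell, basement column 0 included (basement entry of row r is r).
val : {n : ℕ} → Filling n → Fin n → ℕ → ℕ
val T r zero    = suc (toℕ r)
val T r (suc c) = T r (suc c)

ValidEntries : {n : ℕ} → Comp n → Filling n → Set
ValidEntries {n} a T = ∀ r c → 1 ≤ c → c ≤ a r → (1 ≤ T r c) × (T r c ≤ n)

NonAttacking : {n : ℕ} → Comp n → Filling n → Set
NonAttacking a T =
    (∀ r s c → r ≢ s → c ≤ a r → c ≤ a s → val T r c ≢ val T s c)
  × (∀ r s c → toℕ s < toℕ r → c ≤ a r → suc c ≤ a s → val T r c ≢ val T s (suc c))

_≺_ : ℕ × ℕ → ℕ × ℕ → Set
(e , c) ≺ (e' , c') = (e < e') ⊎ ((e ≡ e') × (c' < c))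

_≺?_ : (p q : ℕ × ℕ) → Dec (p ≺ q)
(e , c) ≺? (e' , c') = (e <? e') ⊎-dec ((e ≟ e') ×-dec (c' <? c))

CoInv : ℕ × ℕ → ℕ × ℕ → ℕ × ℕ → Set
CoInv α β γ = ((α ≺ β) × (β ≺ γ)) ⊎ ((β ≺ γ) × (γ ≺ α)) ⊎ ((γ ≺ α) × (α ≺ β))

CoInv? : (α β γ : ℕ × ℕ) → Dec (CoInv α β γ)
CoInv? α β γ = ((α ≺? β) ×-dec (β ≺? γ)) ⊎-dec ((β ≺? γ) ×-dec (γ ≺? α))
                 ⊎-dec ((γ ≺? α) ×-dec (α ≺? β))

NoCoInvI : {n : ℕ} → Comp n → Filling n → Set
NoCoInvI a T = ∀ r s c → toℕ r < toℕ s → a s < a r → suc c ≤ a r → c ≤ a s →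
  ¬ CoInv (val T r c , c) (val T r (suc c) , suc c) (val T s c , c)

NoCoInvII : {n : ℕ} → Comp n → Filling n → Set
NoCoInvII a T = ∀ r s c → toℕ s < toℕ r → a s ≤ a r → suc c ≤ a r → suc c ≤ a s →
  ¬ CoInv (val T r c , c) (val T r (suc c) , suc c) (val T s (suc c) , suc c)

SSKD : {n : ℕ} → Comp n → Filling n → Set
SSKD a T = ValidEntries a T × NonAttacking a T × NoCoInvI a T × NoCoInvII a T

s0· : {k : ℕ} → Comp (suc k) → Comp (suc k)
s0· {k} a fzero = a (fromℕ k) + 1
s0· {k} a (fsuc r) with fsuc r ≟ᶠ fromℕ k
... | yes _ = a fzero ∸ 1
... | no  _ = a (fsuc r)

-- The "bad" test of the embedding map: cells (row 1, col j) with entry α,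
-- (row 1, col j+1) with entry β, (row n, col j) with entry γ form a Type I
-- co-inversion triple, or contain an attacking pair (the only possible
-- attacking pairs are γ,α (same column) and γ,β (γ is in the higher row of
-- the left column)).
Bad? : (j α β γ : ℕ) → Dec (CoInv (α , j) (β , suc j) (γ , j) ⊎ (γ ≡ α) ⊎ (γ ≡ β))
Bad? j α β γ = CoInv? (α , j) (β , suc j) (γ , j) ⊎-dec (γ ≟ α) ⊎-dec (γ ≟ β)

module Embedding {k : ℕ} (a : Comp (suc k)) (T : Filling (suc k)) where
  x y : ℕ → ℕ
  x j = T fzero j
  y j = T (fromℕ k) j

  -- step j (α , tag): α is the entry of row 1, column j of E₀(T) and
  -- tag = true iff that entry is x_j (false iff it is y_{j-1}).
  -- Returns (entry of row n col j , entry of row 1 col j+1 , tag for col j+1).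
  step : ℕ → ℕ × Bool → ℕ × ℕ × Bool
  step j (α , true) =
    if does (Bad? j α (x (suc j)) (y j))
    then (x (suc j) , y j , false)
    else (y j , x (suc j) , true)
  step j (α , false) =
    if does (Bad? j α (y j) (x (suc j)))
    then (y j , x (suc j) , true)
    else (x (suc j) , y j , false)

  -- st m = state at column m+1 of row 1.
  st : ℕ → ℕ × Bool
  st zero    = (x 1 , true)
  st (suc m) = proj₂ (step (suc m) (st m))

  row1 : ℕ → ℕ
  row1 zero    = 0   -- basement, never used
  row1 (suc j) = if does (suc j ≤? a fzero) then proj₁ (st j) else y j

  rowN : ℕ → ℕ
  rowN zero    = 0   -- basement, never used
  rowN (suc j) = proj₁ (step (suc j) (st j))

  E₀ : Filling (suc k)
  E₀ fzero c = row1 c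
  E₀ (fsuc r) c with fsuc r ≟ᶠ fromℕ k
  ... | yes _ = rowN c
  ... | no  _ = T (fsuc r) c

E₀ : {k : ℕ} → Comp (suc k) → Filling (suc k) → Filling (suc k)
E₀ a T = Embedding.E₀ a T

-- Only rows 1 and n of s₀·a are nonempty and row n is the shorter one, so every condition
-- on E₀(T) concerns either the first cell of row 1, which is 1 as in T, or a configuration
-- (row 1, col j), (row 1, col j+1), (row n, col j).  The step at column j fills the last two
-- cells with x_{j+1} and y_j in one order, or swaps them if that order is bad.  Since T is
-- non-attacking, x_{j+1} ≠ y_j, and for distinct entries at most one of the two orders is bad.
module Submission where

open import Defs
open import Data.Nat using (ℕ; zero; suc; _≤_; _<_; _∸_; z≤n; s≤s; _≤?_)
open import Data.Nat.Properties
  using (<-isStrictPartialOrder; <-irrefl; <-asym; <-cmp; n≤1+n; ≤-refl; ≤-reflexive; ≤-trans; <-≤-trans; ≤-pred; +-comm; m∸n≤m; 1+n≰n; m+1+n≰m; suc-injective)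
open import Data.Fin using (Fin; toℕ; fromℕ; fromℕ<) renaming (zero to fzero; suc to fsuc; _≟_ to _≟ᶠ_)
open import Data.Fin.Properties using (toℕ-injective; toℕ-fromℕ<; toℕ-fromℕ; toℕ<n)
open import Data.Bool using (Bool; true; false; if_then_else_)
open import Data.Product using (_×_; _,_; proj₁; proj₂)
import Data.Product as Product
open import Data.Product.Relation.Binary.Lex.Strict using (×-isStrictPartialOrder)
open import Data.Product.Relation.Binary.Pointwise.NonDependent using (Pointwise)
open import Data.Sum using (_⊎_; inj₁; inj₂; swap)
open import Data.Empty using (⊥-elim)
open import Function using (_∘_)
open import Relation.Binary using (IsStrictPartialOrder; tri<; tri≈; tri>)
import Relation.Binary.Construct.Flip.EqAndOrd as Flip
open import Relation.Binary.PropositionalEquality using (_≡_; _≢_; refl; sym; trans; cong; subst)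
open import Relation.Nullary using (¬_; Dec; does; yes; no)
open import Relation.Nullary.Decidable using (dec-true; dec-false)

-- _≺_ is definitionally the lexicographic product of _<_ on entries and _>_ on columns.
≺-isStrictPartialOrder : IsStrictPartialOrder (Pointwise _≡_ _≡_) _≺_
≺-isStrictPartialOrder =
  ×-isStrictPartialOrder <-isStrictPartialOrder (Flip.isStrictPartialOrder <-isStrictPartialOrder)

open IsStrictPartialOrder ≺-isStrictPartialOrder using () renaming (trans to ≺-trans; asym to ≺-asym)

≺-irrefl : ∀ {u} → ¬ (u ≺ u)
≺-irrefl = IsStrictPartialOrder.irrefl ≺-isStrictPartialOrder (refl , refl)

≺-acyclic : ∀ {u v w} → u ≺ v → v ≺ w → ¬ (w ≺ u)
≺-acyclic uv vw wu = ≺-irrefl (≺-trans (≺-trans uv vw) wu)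

right≺left : ∀ e c → (e , suc c) ≺ (e , c)
right≺left e c = inj₂ (refl , ≤-refl)

≺-adjacent : ∀ e c {u} → (e , suc c) ≺ u → ¬ (u ≺ (e , c))
≺-adjacent e c (inj₁ e<g)          (inj₁ g<e)          = <-asym e<g g<e
≺-adjacent e c (inj₁ e<g)          (inj₂ (refl , _))   = <-irrefl refl e<g
≺-adjacent e c (inj₂ (refl , _))   (inj₁ g<e)          = <-irrefl refl g<e
≺-adjacent e c (inj₂ (refl , d≤c)) (inj₂ (_ , c<d))    = 1+n≰n (≤-trans c<d (≤-pred d≤c))

coInv-descending : ∀ {α β γ} → CoInv α β γ → γ ≺ β → γ ≺ α × α ≺ β
coInv-descending (inj₁ (_ , βγ))         γβ = ⊥-elim (≺-asym βγ γβ)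
coInv-descending (inj₂ (inj₁ (βγ , _)))  γβ = ⊥-elim (≺-asym βγ γβ)
coInv-descending (inj₂ (inj₂ γα×αβ))     _  = γα×αβ

¬coInv-repeated : ∀ e j γ → ¬ CoInv (e , j) (e , suc j) γ
¬coInv-repeated e j γ (inj₁ (αβ , _))          = ≺-asym αβ (right≺left e j)
¬coInv-repeated e j γ (inj₂ (inj₁ (βγ , γα)))  = ≺-adjacent e j βγ γα
¬coInv-repeated e j γ (inj₂ (inj₂ (_ , αβ)))   = ≺-asym αβ (right≺left e j)

-- The second triple forces (p , j) ≺ α ≺ (q , suc j), a range the first one excludes.
coInv-swap-< : ∀ {j α p q} → p < q →
  CoInv (α , j) (p , suc j) (q , j) → ¬ CoInv (α , j) (q , suc j) (p , j)
coInv-swap-< {j} {α} {p} {q} p<q co co' with coInv-descending co' (inj₁ p<q) | co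
... | Pα , _  | inj₁ (αP' , _)        = ≺-acyclic Pα αP' (right≺left p j)
... | _ , αQ' | inj₂ (inj₁ (_ , Qα))  = ≺-acyclic αQ' (right≺left q j) Qα
... | _ , αQ' | inj₂ (inj₂ (Qα , _))  = ≺-acyclic αQ' (right≺left q j) Qα

coInv-swap : ∀ {j α p q} → p ≢ q →
  CoInv (α , j) (p , suc j) (q , j) → ¬ CoInv (α , j) (q , suc j) (p , j)
coInv-swap {p = p} {q} p≢q with <-cmp p q
... | tri< p<q _ _ = coInv-swap-< p<q
... | tri≈ _ p≡q _ = ⊥-elim (p≢q p≡q)
... | tri> _ _ q<p = λ co co' → coInv-swap-< q<p co' co

Bad : (j α β γ : ℕ) → Set
Bad j α β γ = CoInv (α , j) (β , suc j) (γ , j) ⊎ (γ ≡ α) ⊎ (γ ≡ β)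

Bad-asym : ∀ {j α p q} → p ≢ q → Bad j α p q → ¬ Bad j α q p
Bad-asym p≢q _                     (inj₂ (inj₂ p≡q))     = p≢q p≡q
Bad-asym p≢q (inj₂ (inj₂ q≡p))     _                     = p≢q (sym q≡p)
Bad-asym p≢q (inj₂ (inj₁ q≡α))     (inj₂ (inj₁ p≡α))     = p≢q (trans p≡α (sym q≡α))
Bad-asym {j} {p = p} {q} p≢q (inj₂ (inj₁ refl)) (inj₁ co) = ¬coInv-repeated q j (p , j) co
Bad-asym {j} {p = p} {q} p≢q (inj₁ co) (inj₂ (inj₁ refl)) = ¬coInv-repeated p j (q , j) co
Bad-asym p≢q (inj₁ co)             (inj₁ co')            = coInv-swap p≢q co co'

OneOf : ℕ → ℕ → ℕ → Set
OneOf u v w = w ≡ u ⊎ w ≡ v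

OneOf-elim : ∀ {P : ℕ → Set} {u v w} → P u → P v → OneOf u v w → P w
OneOf-elim Pu _ (inj₁ refl) = Pu
OneOf-elim _ Pv (inj₂ refl) = Pv

-- Stated for an arbitrary d: the goal for `step` normalises `does (Bad? …)` to a boolean
-- expression that `with` cannot abstract.
choice-¬Bad : ∀ {j α p q} {t u : Bool} → p ≢ q → (d : Dec (Bad j α p q)) →
  let (γ , β , _) = if does d then (p , q , t) else (q , p , u) in ¬ Bad j α β γ
choice-¬Bad p≢q (yes bad) = Bad-asym p≢q bad
choice-¬Bad p≢q (no ¬bad) = ¬bad

choice-entries : ∀ {P : Set} {p q} {t u : Bool} (d : Dec P) →
  let (γ , β , _) = if does d then (p , q , t) else (q , p , u) in OneOf p q γ × OneOf p q β
choice-entries (yes _) = inj₁ refl , inj₂ refl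
choice-entries (no _)  = inj₂ refl , inj₁ refl

module _ {k : ℕ} (a : Comp (suc k)) (T : Filling (suc k)) where
  open Embedding a T using (x; y; step)

  step-¬Bad : ∀ j s → x (suc j) ≢ y j →
    ¬ Bad j (proj₁ s) (proj₁ (proj₂ (step j s))) (proj₁ (step j s))
  step-¬Bad j (α , true)  x≢y = choice-¬Bad x≢y (Bad? j α (x (suc j)) (y j))
  step-¬Bad j (α , false) x≢y = choice-¬Bad (x≢y ∘ sym) (Bad? j α (y j) (x (suc j)))

  step-entries : ∀ j s → OneOf (x (suc j)) (y j) (proj₁ (step j s))
                       × OneOf (x (suc j)) (y j) (proj₁ (proj₂ (step j s)))
  step-entries j (α , true)  = choice-entries (Bad? j α (x (suc j)) (y j))
  step-entries j (α , false) = Product.map swap swap (choice-entries (Bad? j α (y j) (x (suc j))))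

s0·-last : ∀ {m} (a : Comp (suc (suc m))) → s0· a (fromℕ (suc m)) ≡ a fzero ∸ 1
s0·-last {m} a with fsuc (fromℕ m) ≟ᶠ fromℕ (suc m)
... | yes _ = refl
... | no ne = ⊥-elim (ne refl)

s0·-middle : ∀ {k} (a : Comp (suc k)) r → fsuc r ≢ fromℕ k → s0· a (fsuc r) ≡ a (fsuc r)
s0·-middle {k} a r ne with fsuc r ≟ᶠ fromℕ k
... | yes eq = ⊥-elim (ne eq)
... | no _   = refl

E₀-last : ∀ {m} (a : Comp (suc (suc m))) T c → E₀ a T (fromℕ (suc m)) c ≡ Embedding.rowN a T c
E₀-last {m} a T c with fsuc (fromℕ m) ≟ᶠ fromℕ (suc m)
... | yes _ = refl
... | no ne = ⊥-elim (ne refl)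

-- The basement entries 2, …, n of the higher rows attack the first cell of row 1.
first-cell≡1 : ∀ {k} {a : Comp (suc k)} {T} →
  ValidEntries a T → NonAttacking a T → 0 < a fzero → T fzero 1 ≡ 1
first-cell≡1 {k} {a} {T} valid (_ , attack) 0<a₁ =
  only-1 (T fzero 1) (valid fzero 1 ≤-refl 0<a₁) (λ r 0<r → attack r fzero 0 0<r z≤n 0<a₁)
  where
  only-1 : ∀ v → 1 ≤ v × v ≤ suc k → (∀ (r : Fin (suc k)) → 0 < toℕ r → suc (toℕ r) ≢ v) → v ≡ 1
  only-1 (suc zero)    _         _        = refl
  only-1 (suc (suc w)) (_ , w<k) basement≢ =
    ⊥-elim (basement≢ (fromℕ< w<k) (subst (0 <_) (sym (toℕ-fromℕ< w<k)) (s≤s z≤n))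
                      (cong suc (toℕ-fromℕ< w<k)))

data RowView {m : ℕ} : Fin (suc (suc m)) → Set where
  first  : RowView fzero
  last   : RowView (fromℕ (suc m))
  middle : ∀ r → fsuc r ≢ fromℕ (suc m) → RowView (fsuc r)

rowView : ∀ {m} (r : Fin (suc (suc m))) → RowView r
rowView fzero = first
rowView {m} (fsuc r) with fsuc r ≟ᶠ fromℕ (suc m)
... | yes eq = subst RowView (sym eq) last
... | no ne  = middle r ne

module E₀-SSKD (m : ℕ) (a : Comp (suc (suc m)))
  (a-middle≡0 : ∀ r → r ≢ fzero → r ≢ fromℕ (suc m) → a r ≡ 0)
  (a₁≤aₙ : a fzero ≤ a (fromℕ (suc m))) (0<a₁ : 0 < a fzero)
  (T : Filling (suc (suc m))) (T∈SSKD : SSKD a T) where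

  open Embedding a T using (x; y; st; row1; rowN)

  L : Fin (suc (suc m))
  L = fromℕ (suc m)

  b : Comp (suc (suc m))
  b = s0· a

  E : Filling (suc (suc m))
  E = E₀ a T

  InRange : ℕ → Set
  InRange v = 1 ≤ v × v ≤ suc (suc m)

  valid : ValidEntries a T
  valid = proj₁ T∈SSKD

  b-last : b L ≡ a fzero ∸ 1
  b-last = s0·-last a

  middle-row-empty : ∀ {r c} → fsuc r ≢ L → ¬ (suc c ≤ b (fsuc r))
  middle-row-empty {r} ne h
    with ≤-trans h (≤-reflexive (trans (s0·-middle a r ne) (a-middle≡0 (fsuc r) (λ ()) ne)))
  ... | ()

  nothing-above-last : ∀ r → ¬ (toℕ L < toℕ r)
  nothing-above-last r lt =
    <-irrefl refl (<-≤-trans (toℕ<n r) (subst (_< toℕ r) (toℕ-fromℕ (suc m)) lt))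

  last-cell⇒first-cell : ∀ {j} → suc j ≤ b L → suc (suc j) ≤ a fzero
  last-cell⇒first-cell h = ≤∸1⇒< 0<a₁ (subst (_ ≤_) b-last h)
    where
    ≤∸1⇒< : ∀ {n c} → 0 < n → c ≤ n ∸ 1 → c < n
    ≤∸1⇒< {suc _} _ c≤n = s≤s c≤n

  row1-inside : ∀ j → suc j ≤ a fzero → row1 (suc j) ≡ proj₁ (st j)
  row1-inside j h = cong (if_then proj₁ (st j) else y j) (dec-true (suc j ≤? a fzero) h)

  row1-outside : ∀ j → ¬ (suc j ≤ a fzero) → row1 (suc j) ≡ y j
  row1-outside j ¬h = cong (if_then proj₁ (st j) else y j) (dec-false (suc j ≤? a fzero) ¬h)

  E-first-cell≡1 : row1 1 ≡ 1
  E-first-cell≡1 = trans (row1-inside 0 0<a₁) (first-cell≡1 valid (proj₁ (proj₂ T∈SSKD)) 0<a₁)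

  x≢y : ∀ j → suc (suc j) ≤ a fzero → x (suc (suc j)) ≢ y (suc j)
  x≢y j h x≡y = proj₂ (proj₁ (proj₂ T∈SSKD)) L fzero (suc j) (s≤s z≤n)
    (≤-trans (≤-trans (n≤1+n _) h) a₁≤aₙ) h (sym x≡y)

  ¬Bad-E : ∀ j → suc j ≤ b L → ¬ Bad (suc j) (row1 (suc j)) (row1 (suc (suc j))) (E L (suc j))
  ¬Bad-E j h
    rewrite E₀-last a T (suc j)
          | row1-inside j (≤-trans (n≤1+n _) (last-cell⇒first-cell h))
          | row1-inside (suc j) (last-cell⇒first-cell h)
    = step-¬Bad a T (suc j) (st j) (x≢y j (last-cell⇒first-cell h))

  step-in-range : ∀ j → suc (suc j) ≤ a fzero →
    InRange (proj₁ (Embedding.step a T (suc j) (st j))) × InRange (row1 (suc (suc j)))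
  step-in-range j h rewrite row1-inside (suc j) h =
    Product.map (OneOf-elim {InRange} x-ok y-ok) (OneOf-elim {InRange} x-ok y-ok)
                (step-entries a T (suc j) (st j))
    where
    x-ok = valid fzero (suc (suc j)) (s≤s z≤n) h
    y-ok = valid L (suc j) (s≤s z≤n) (≤-trans (≤-trans (n≤1+n _) h) a₁≤aₙ)

  E-in-range : ∀ {r} → RowView r → ∀ c → 1 ≤ c → c ≤ b r → InRange (E r c)
  E-in-range first (suc zero) _ _ = subst InRange (sym E-first-cell≡1) (≤-refl , s≤s z≤n)
  E-in-range first (suc (suc j)) _ h with suc (suc j) ≤? a fzero
  ... | yes inside = proj₂ (step-in-range j inside)
  ... | no outside = subst InRange (sym (row1-outside (suc j) outside))
                       (valid L (suc j) (s≤s z≤n) (≤-pred (subst (suc (suc j) ≤_) (+-comm (a L) 1) h)))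
  E-in-range last (suc j) _ h =
    subst InRange (sym (E₀-last a T (suc j))) (proj₁ (step-in-range j (last-cell⇒first-cell h)))
  E-in-range (middle r ne) (suc c) _ h = ⊥-elim (middle-row-empty ne h)

  E-column-distinct : ∀ {r s} → RowView r → RowView s → ∀ j → r ≢ s →
    suc j ≤ b r → suc j ≤ b s → E r (suc j) ≢ E s (suc j)
  E-column-distinct (middle r ne) _ j _ h _ = ⊥-elim (middle-row-empty ne h)
  E-column-distinct _ (middle s ne) j _ _ h = ⊥-elim (middle-row-empty ne h)
  E-column-distinct first first j r≢s _ _ = ⊥-elim (r≢s refl)
  E-column-distinct last  last  j r≢s _ _ = ⊥-elim (r≢s refl)
  E-column-distinct first last  j _ _ h e = ¬Bad-E j h (inj₂ (inj₁ (sym e)))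
  E-column-distinct last  first j _ h _ e = ¬Bad-E j h (inj₂ (inj₁ e))

  E-diagonal-distinct : ∀ {r s} → RowView r → RowView s → ∀ c → toℕ s < toℕ r →
    c ≤ b r → suc c ≤ b s → val E r c ≢ val E s (suc c)
  E-diagonal-distinct _ (middle s ne) c _ _ h = ⊥-elim (middle-row-empty ne h)
  E-diagonal-distinct {r} _ last c lt _ _ = ⊥-elim (nothing-above-last r lt)
  E-diagonal-distinct _ first zero lt _ _ e =
    <-irrefl (sym (suc-injective (trans e E-first-cell≡1))) lt
  E-diagonal-distinct first first (suc j) () _ _
  E-diagonal-distinct (middle r ne) first (suc j) _ h _ = ⊥-elim (middle-row-empty ne h)
  E-diagonal-distinct last first (suc j) _ h _ e = ¬Bad-E j h (inj₂ (inj₂ e))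

  E-no-coInvI : ∀ {r s} → RowView r → RowView s → ∀ c → toℕ r < toℕ s → b s < b r →
    suc c ≤ b r → c ≤ b s → ¬ CoInv (val E r c , c) (val E r (suc c) , suc c) (val E s c , c)
  E-no-coInvI (middle r ne) _ c _ _ h _ = ⊥-elim (middle-row-empty ne h)
  E-no-coInvI {s = s} last _ c lt _ _ _ = ⊥-elim (nothing-above-last s lt)
  E-no-coInvI first _ zero _ _ _ _ =
    subst (λ v → ¬ CoInv (1 , 0) (v , 1) _) (sym E-first-cell≡1) (¬coInv-repeated 1 0 _)
  E-no-coInvI first first (suc j) () _ _ _
  E-no-coInvI first (middle s ne) (suc j) _ _ _ h = ⊥-elim (middle-row-empty ne h)
  E-no-coInvI first last (suc j) _ _ _ h co = ¬Bad-E j h (inj₁ co)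

  -- Row 1 of s₀·a is longer than row n, so no Type II triple has its lower cell in row 1.
  E-no-coInvII : ∀ {r s} → RowView r → RowView s → ∀ c → toℕ s < toℕ r → b s ≤ b r →
    suc c ≤ b r → suc c ≤ b s →
    ¬ CoInv (val E r c , c) (val E r (suc c) , suc c) (val E s (suc c) , suc c)
  E-no-coInvII first _ c () _ _ _
  E-no-coInvII (middle r ne) _ c _ _ h _ = ⊥-elim (middle-row-empty ne h)
  E-no-coInvII last (middle s ne) c _ _ _ h = ⊥-elim (middle-row-empty ne h)
  E-no-coInvII last last c lt _ _ _ = ⊥-elim (<-irrefl refl lt)
  E-no-coInvII last first c _ b₁≤bₙ _ _ = ⊥-elim (m+1+n≰m (a L)
    (≤-trans b₁≤bₙ (≤-trans (≤-reflexive b-last) (≤-trans (m∸n≤m (a fzero) 1) a₁≤aₙ))))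

  E∈SSKD : SSKD b E
  E∈SSKD =
      (λ r → E-in-range (rowView r))
    , ( (λ { r s zero r≢s _ _ → r≢s ∘ toℕ-injective ∘ suc-injective
           ; r s (suc j) → E-column-distinct (rowView r) (rowView s) j })
      , λ r s → E-diagonal-distinct (rowView r) (rowView s))
    , (λ r s → E-no-coInvI (rowView r) (rowView s))
    , (λ r s → E-no-coInvII (rowView r) (rowView s))

lemma4p4 : (m : ℕ) → (a : Comp (suc (suc m))) →
    (∀ r → r ≢ fzero → r ≢ fromℕ (suc m) → a r ≡ 0) →
    a fzero ≤ a (fromℕ (suc m)) → 0 < a fzero →
    (T : Filling (suc (suc m))) → SSKD a T → SSKD (s0· a) (E₀ a T)
lemma4p4 = E₀-SSKD.E∈SSKD
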